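{- Let $m=2n+1\ge 5$ be odd and let $\varphi=(\mathcal A_1,\dots,\mathcal A_m)$ be a ring (as defined in the context). Every maximum independent set of the ring graph of $\varphi$ belongs to $\Pi_i$ for some $i\in\{1,\dots,m\}$.
   Context: Indices are taken cyclically modulo $m$. A ring is a sequence $\varphi=(\mathcal A_1,\dots,\mathcal A_m)$ of pairwise disjoint finite vertex sets such that $|\mathcal A_i|\ge 1$ and $|\mathcal A_i|+|\mathcal A_{i+1}|\le m$ for all $i$, and $\sum_{i=1}^m|\mathcal A_i| = m\lfloor m/2\rfloor$. The ring graph has vertex set $\bigcup_i\mathcal A_i$, two distinct vertices $u\in\mathcal A_i$, $v\in\mathcal A_j$ being adjacent iff $j\in\{i-1,i,i+1\}$ mod $m$; its maximum independent sets have size $n$. For $i=1,\dots,m$, $\Pi_i$ is the family of all sets $\{v_0,\dots,v_{n-1}\}$ with $v_k\in\mathcal A_{i+2k}$ for $k=0,\dots,n-1$. -}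

module Defs where

open import Data.Nat using (ℕ; zero; suc; _+_; _*_; _≤_; _/_)
open import Data.Nat.DivMod using (_mod_)
open import Data.Fin using (Fin; toℕ)
open import Data.List using (List; length; tabulate)
open import Data.Nat.ListAction using (sum)
open import Data.List.Membership.Propositional using (_∈_)
open import Data.List.Relation.Unary.Unique.Propositional using (Unique)
open import Data.Product using (Σ; _×_; _,_; proj₁; ∃)
open import Data.Sum using (_⊎_)
open import Relation.Binary.PropositionalEquality using (_≡_; _≢_)
open import Function.Bundles using (_⇔_)

-- Cycle length m = 2n+1 (odd); ring positions are Fin m (0-based, i.e. A_1..A_m
-- of the paper are indexed 0..m-1 here).
ringLen : ℕ → ℕ
ringLen n = suc (2 * n)

shift : ∀ n → Fin (ringLen n) → ℕ → Fin (ringLen n)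
shift n i d = (toℕ i + d) mod ringLen n

-- A ring is given by the sizes a i = |A_i| (the sets A_i are pairwise disjoint,
-- so we realise A_i as {i} × Fin (a i)).
IsRing : (n : ℕ) → (Fin (ringLen n) → ℕ) → Set
IsRing n a =
  (∀ i → 1 ≤ a i) ×
  (∀ i → a i + a (shift n i 1) ≤ ringLen n) ×
  (sum (tabulate a) ≡ ringLen n * (ringLen n / 2))

Vertex : (n : ℕ) → (Fin (ringLen n) → ℕ) → Set
Vertex n a = Σ (Fin (ringLen n)) (λ i → Fin (a i))

Adj : ∀ {n a} → Vertex n a → Vertex n a → Set
Adj {n} {a} u v =
  u ≢ v × (proj₁ v ≡ proj₁ u ⊎ proj₁ v ≡ shift n (proj₁ u) 1 ⊎ proj₁ u ≡ shift n (proj₁ v) 1)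

-- a finite vertex set is a duplicate-free list
Independent : ∀ n a → List (Vertex n a) → Set
Independent n a S = ∀ {u v} → u ∈ S → v ∈ S → Adj {n} {a} u v → Data.Empty.⊥
  where import Data.Empty

IsMaxIndependent : ∀ n a → List (Vertex n a) → Set
IsMaxIndependent n a S =
  Unique S × Independent n a S ×
  (∀ (T : List (Vertex n a)) → Unique T → Independent n a T → length T ≤ length S)

-- S belongs to Π_i : S = {v_0,…,v_{n-1}} with v_k ∈ A_{i+2k}
InPi : ∀ n a → Fin (ringLen n) → List (Vertex n a) → Set
InPi n a i S =
  Σ ((k : Fin n) → Fin (a (shift n i (2 * toℕ k)))) λ f →
    ∀ (x : Vertex n a) → (x ∈ S) ⇔ ∃ (λ (k : Fin n) → x ≡ (shift n i (2 * toℕ k) , f k))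

module Submission where

-- An independent set meets each class A_x in at most one vertex and never meets two cyclically
-- consecutive classes, so its occupancy x ↦ |S ∩ A_x| is a 0/1 sequence around the odd cycle
-- ℤ/m with no two consecutive ones; comparing with the independent set A_0, A_2, …, A_{2n-2}
-- shows that a maximum one has n ones. Such a sequence cannot alternate all the way around an
-- odd cycle, so two consecutive classes A_z, A_{z+1} are empty, and the remaining path of
-- 2n − 1 classes carries n ones with no two adjacent, which pins them to A_{z+2}, A_{z+4}, …,
-- A_{z+2n}: that is, S ∈ Π_{z+2}.

open import Data.Bool using (true; false; if_then_else_)
open import Data.Empty using (⊥-elim)
open import Data.Fin using (Fin; toℕ; fromℕ<)
open import Data.Fin.Properties using (toℕ<n; toℕ-fromℕ<; toℕ-injective) renaming (_≟_ to _≟ᶠ_)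
open import Data.List using (List; []; _∷_; _++_; length; filter; tabulate; applyUpTo)
open import Data.List.Membership.Propositional using (_∈_)
open import Data.List.Membership.Propositional.Properties using (∈-tabulate⁻)
open import Data.List.Properties using (applyUpTo-∷ʳ; filter-none; filter-some; length-tabulate)
open import Data.List.Relation.Unary.All as All using (All)
open import Data.List.Relation.Unary.AllPairs using (_∷_)
open import Data.List.Relation.Unary.Any as Any using (here; there)
open import Data.List.Relation.Unary.Unique.Propositional using (Unique)
open import Data.List.Relation.Unary.Unique.Propositional.Properties using (tabulate⁺)
open import Data.Nat using (ℕ; zero; suc; _+_; _*_; _∸_; _≤_; _<_; z≤n; s≤s; s≤s⁻¹; z<s; _%_; NonZero; _<?_)
open import Data.Nat.DivMod using (_mod_; m<n⇒m%n≡m; n%n≡0; m%n%n≡m%n; [m+n]%n≡m%n; %-distribˡ-+)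
open import Data.Nat.ListAction using (sum)
open import Data.Nat.ListAction.Properties using (sum-++)
open import Data.Nat.Properties
open import Algebra.Properties.CommutativeSemigroup +-commutativeSemigroup using (interchange)
open import Data.Product using (∃; _×_; _,_; proj₁; proj₂)
open import Data.Product.Properties using (≡-dec)
open import Data.Sum using (_⊎_; inj₁; inj₂)
open import Defs
open import Function using (_∘_)
open import Function.Bundles using (_⇔_; mk⇔)
open import Relation.Binary.PropositionalEquality
open import Relation.Nullary using (Dec; does; yes; no; ¬_)
open import Relation.Nullary.Decidable using (does-⇔; _×-dec_)
open import Relation.Unary using (Decidable)

sumUpTo : (ℕ → ℕ) → ℕ → ℕ
sumUpTo f L = sum (applyUpTo f L)

sumUpTo-cong : ∀ {f g} L → (∀ {x} → x < L → f x ≡ g x) → sumUpTo f L ≡ sumUpTo g L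
sumUpTo-cong zero    f≡g = refl
sumUpTo-cong (suc L) f≡g = cong₂ _+_ (f≡g z<s) (sumUpTo-cong L (f≡g ∘ s≤s))

sumUpTo-zero : ∀ L → sumUpTo (λ _ → 0) L ≡ 0
sumUpTo-zero zero    = refl
sumUpTo-zero (suc L) = sumUpTo-zero L

sumUpTo-+ : ∀ f g L → sumUpTo (λ x → f x + g x) L ≡ sumUpTo f L + sumUpTo g L
sumUpTo-+ f g zero    = refl
sumUpTo-+ f g (suc L) =
  trans (cong (f 0 + g 0 +_) (sumUpTo-+ (f ∘ suc) (g ∘ suc) L)) (interchange (f 0) (g 0) _ _)

sumUpTo-suc : ∀ f L → sumUpTo f (suc L) ≡ sumUpTo f L + f L
sumUpTo-suc f L = begin
  sum (applyUpTo f (suc L))        ≡⟨ cong sum (applyUpTo-∷ʳ f L) ⟨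
  sum (applyUpTo f L ++ f L ∷ [])  ≡⟨ sum-++ (applyUpTo f L) (f L ∷ []) ⟩
  sumUpTo f L + (f L + 0)          ≡⟨ cong (sumUpTo f L +_) (+-identityʳ (f L)) ⟩
  sumUpTo f L + f L                ∎
  where open ≡-Reasoning

Periodic : ℕ → (ℕ → ℕ) → Set
Periodic p f = ∀ x → f (x + p) ≡ f x

sumUpTo-rotate : ∀ f L → Periodic L f → ∀ s → sumUpTo (λ r → f (s + r)) L ≡ sumUpTo f L
sumUpTo-rotate f L periodic zero    = refl
sumUpTo-rotate f L periodic (suc s) = trans (+-cancelˡ-≡ (f s) _ _ shifted) (sumUpTo-rotate f L periodic s)
  where
  open ≡-Reasoning
  shifted : f s + sumUpTo (λ r → f (suc s + r)) L ≡ f s + sumUpTo (λ r → f (s + r)) L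
  shifted = begin
    f s + sumUpTo (λ r → f (suc s + r)) L    ≡⟨ cong₂ _+_ (cong f (+-identityʳ s))
                                                          (sumUpTo-cong L λ {r} _ → cong f (+-suc s r)) ⟨
    sumUpTo (λ r → f (s + r)) (suc L)        ≡⟨ sumUpTo-suc (λ r → f (s + r)) L ⟩
    sumUpTo (λ r → f (s + r)) L + f (s + L)  ≡⟨ cong (sumUpTo (λ r → f (s + r)) L +_) (periodic s) ⟩
    sumUpTo (λ r → f (s + r)) L + f s        ≡⟨ +-comm _ (f s) ⟩
    f s + sumUpTo (λ r → f (s + r)) L        ∎

sumUpTo-indicator : ∀ {q L} → q < L → sumUpTo (λ x → if does (q ≟ x) then 1 else 0) L ≡ 1
sumUpTo-indicator {zero}  {suc L} _   = cong suc (sumUpTo-zero L)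
sumUpTo-indicator {suc q} {suc L} q<L = sumUpTo-indicator (s≤s⁻¹ q<L)

record Sparse (f : ℕ → ℕ) : Set where
  constructor sparse
  field adjacent : ∀ x → f x + f (suc x) ≤ 1

module _ {f : ℕ → ℕ} (sp : Sparse f) where
  open Sparse sp

  sparse-≤1 : ∀ x → f x ≤ 1
  sparse-≤1 x = ≤-trans (m≤m+n (f x) _) (adjacent x)

  sparse-shift : ∀ s → Sparse (λ r → f (s + r))
  sparse-shift s = sparse λ r → subst (λ y → f (s + r) + f y ≤ 1) (sym (+-suc s r)) (adjacent (s + r))

  sparse-next-zero : ∀ x → 1 ≤ f x → f (suc x) ≡ 0
  sparse-next-zero x fx≥1 = n≤0⇒n≡0 (+-cancelˡ-≤ 1 _ _ (≤-trans (+-monoˡ-≤ _ fx≥1) (adjacent x)))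

  sparse-prev-zero : ∀ x → 1 ≤ f (suc x) → f x ≡ 0
  sparse-prev-zero x fsx≥1 = n≤0⇒n≡0 (+-cancelʳ-≤ 1 _ 0 (≤-trans (+-monoʳ-≤ (f x) fsx≥1) (adjacent x)))

sumUpTo-sparse-even-≤ : ∀ {f} → Sparse f → ∀ l → sumUpTo f (2 * l) ≤ l
sumUpTo-sparse-even-≤ sp zero = z≤n
sumUpTo-sparse-even-≤ {f} sp (suc l) = begin
  sumUpTo f (2 * suc l)                            ≡⟨ cong (sumUpTo f) (*-suc 2 l) ⟩
  f 0 + (f 1 + sumUpTo (λ r → f (2 + r)) (2 * l))  ≡⟨ +-assoc (f 0) (f 1) _ ⟨
  f 0 + f 1 + sumUpTo (λ r → f (2 + r)) (2 * l)    ≤⟨ +-mono-≤ (Sparse.adjacent sp 0)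
                                                               (sumUpTo-sparse-even-≤ (sparse-shift sp 2) l) ⟩
  suc l                                            ∎
  where open ≤-Reasoning

sumUpTo-sparse-odd-≤ : ∀ {f} → Sparse f → ∀ l → sumUpTo f (suc (2 * l)) ≤ suc l
sumUpTo-sparse-odd-≤ sp l = +-mono-≤ (sparse-≤1 sp 0) (sumUpTo-sparse-even-≤ (sparse-shift sp 1) l)

sparse-saturated-even : ∀ {f} → Sparse f → ∀ l → suc l ≤ sumUpTo f (suc (2 * l)) →
                        ∀ k → k ≤ l → 1 ≤ f (2 * k)
sparse-saturated-even {f} sp zero    full .zero z≤n = subst (1 ≤_) (+-identityʳ (f 0)) full
sparse-saturated-even {f} sp (suc l) full = occupied
  where
  tail = sumUpTo (λ r → f (2 + r)) (suc (2 * l))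
  full′ : 2 + l ≤ (f 0 + f 1) + tail
  full′ = subst (2 + l ≤_) (trans (cong (sumUpTo f ∘ suc) (*-suc 2 l)) (sym (+-assoc (f 0) (f 1) tail))) full
  tail-full : suc l ≤ tail
  tail-full = s≤s⁻¹ (≤-trans full′ (+-monoˡ-≤ tail (Sparse.adjacent sp 0)))
  head-full : 1 ≤ f 0 + f 1
  head-full = +-cancelʳ-≤ (suc l) 1 _ (≤-trans full′ (+-monoʳ-≤ _ (sumUpTo-sparse-odd-≤ (sparse-shift sp 2) l)))
  occupied-tail : ∀ k → k ≤ l → 1 ≤ f (2 + 2 * k)
  occupied-tail = sparse-saturated-even (sparse-shift sp 2) l tail-full
  occupied : ∀ k → k ≤ suc l → 1 ≤ f (2 * k)
  occupied zero _ = begin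
    1          ≤⟨ head-full ⟩
    f 0 + f 1  ≡⟨ cong (f 0 +_) (sparse-prev-zero sp 1 (occupied-tail 0 z≤n)) ⟩
    f 0 + 0    ≡⟨ +-identityʳ (f 0) ⟩
    f 0        ∎
    where open ≤-Reasoning
  occupied (suc k) k≤l = subst (λ y → 1 ≤ f y) (sym (*-suc 2 k)) (occupied-tail k (s≤s⁻¹ k≤l))

even-or-odd : ∀ r → ∃ λ k → r ≡ 2 * k ⊎ r ≡ suc (2 * k)
even-or-odd zero = 0 , inj₁ refl
even-or-odd (suc r) with even-or-odd r
... | k , inj₁ r≡2k   = k , inj₂ (cong suc r≡2k)
... | k , inj₂ r≡1+2k = suc k , inj₁ (trans (cong suc r≡1+2k) (sym (*-suc 2 k)))

sparse-saturated-support : ∀ {f} → Sparse f → ∀ l → suc l ≤ sumUpTo f (suc (2 * l)) →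
                           ∀ r → r ≤ 2 * l → 1 ≤ f r → ∃ λ k → k ≤ l × r ≡ 2 * k
sparse-saturated-support {f} sp l full r r≤2l fr≥1 with even-or-odd r
... | k , inj₁ refl = k , *-cancelˡ-≤ 2 r≤2l , refl
... | k , inj₂ refl = ⊥-elim (1+n≰n (subst (1 ≤_) odd-empty fr≥1))
  where
  odd-empty : f (suc (2 * k)) ≡ 0
  odd-empty = sparse-next-zero sp (2 * k)
    (sparse-saturated-even sp l full k (*-cancelˡ-≤ 2 (≤-trans (n≤1+n (2 * k)) r≤2l)))

-- Without two consecutive zeros the sequence alternates, so f 1 = f (1 + 2n) = f 0,
-- contradicting f 0 + f 1 = 1.
sparse-odd-cycle-gap : ∀ {f} n → Sparse f → Periodic (suc (2 * n)) f →
                       ∃ λ z → z < suc (2 * n) × f z ≡ 0 × f (suc z) ≡ 0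
sparse-odd-cycle-gap {f} n sp periodic with anyUpTo? (λ z → (f z ≟ 0) ×-dec (f (suc z) ≟ 0)) (suc (2 * n))
... | yes gap   = gap
... | no no-gap = ⊥-elim (even≢odd (f 0) 0 twice-f0≡1)
  where
  m = suc (2 * n)
  alternating : ∀ x → x < m → f x + f (suc x) ≡ 1
  alternating x x<m = ≤-antisym (Sparse.adjacent sp x) (n≢0⇒n>0 λ sum≡0 →
    no-gap (x , x<m , m+n≡0⇒m≡0 (f x) sum≡0 , m+n≡0⇒n≡0 (f x) sum≡0))
  two-step : ∀ x → suc x < m → f (suc (suc x)) ≡ f x
  two-step x sx<m = +-cancelʳ-≡ (f (suc x)) _ _ (begin
    f (suc (suc x)) + f (suc x)  ≡⟨ +-comm (f (suc (suc x))) _ ⟩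
    f (suc x) + f (suc (suc x))  ≡⟨ alternating (suc x) sx<m ⟩
    1                            ≡⟨ alternating x (<-trans (n<1+n x) sx<m) ⟨
    f x + f (suc x)              ∎)
    where open ≡-Reasoning
  even-steps : ∀ k x → 2 * k + x ≤ m → f (2 * k + x) ≡ f x
  even-steps zero    x _  = refl
  even-steps (suc k) x le = trans (cong (λ y → f (y + x)) (*-suc 2 k))
    (trans (two-step (2 * k + x) le′) (even-steps k x (≤-trans (n≤1+n _) (≤-trans (n≤1+n _) le′))))
    where
    le′ : 2 + (2 * k + x) ≤ m
    le′ = subst (λ y → y + x ≤ m) (*-suc 2 k) le
  twice-f0≡1 : 2 * f 0 ≡ 1
  twice-f0≡1 = begin
    f 0 + (f 0 + 0)    ≡⟨ cong (f 0 +_) (+-identityʳ (f 0)) ⟩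
    f 0 + f 0          ≡⟨ cong (f 0 +_) (periodic 0) ⟨
    f 0 + f m          ≡⟨ cong (λ y → f 0 + f y) (+-comm 1 (2 * n)) ⟩
    f 0 + f (2 * n + 1) ≡⟨ cong (f 0 +_) (even-steps n 1 (≤-reflexive (+-comm (2 * n) 1))) ⟩
    f 0 + f 1          ≡⟨ alternating 0 z<s ⟩
    1                  ∎
    where open ≡-Reasoning

offset-between : ∀ {z y m} → z ≤ y → y < z + m → ∃ λ r → r < m × z + r ≡ y
offset-between {z} {y} z≤y y<z+m = y ∸ z , +-cancelˡ-< z _ _ (subst (_< z + _) (sym z+r≡y) y<z+m) , z+r≡y
  where z+r≡y = m+[n∸m]≡n z≤y

cyclic-offset : ∀ {f} m .{{_ : NonZero m}} → Periodic m f → ∀ {z x} → z < m → x < m →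
                ∃ λ r → r < m × f (z + r) ≡ f x × (z + r) % m ≡ x
cyclic-offset {f} m periodic {z} {x} z<m x<m with z ≤? x
... | yes z≤x with offset-between z≤x (<-≤-trans x<m (m≤n+m m z))
...   | r , r<m , refl = r , r<m , refl , m<n⇒m%n≡m x<m
cyclic-offset {f} m periodic {z} {x} z<m x<m | no z≰x
  with offset-between (≤-trans (<⇒≤ z<m) (m≤n+m m x)) (+-monoˡ-< m (≰⇒> z≰x))
... | r , r<m , z+r≡x+m = r , r<m , trans (cong f z+r≡x+m) (periodic x) ,
                           trans (cong (_% m) z+r≡x+m) (trans ([m+n]%n≡m%n x m) (m<n⇒m%n≡m x<m))

sparse-saturated-odd-cycle :
  ∀ {f} n → 1 ≤ n → Sparse f → Periodic (suc (2 * n)) f → n ≤ sumUpTo f (suc (2 * n)) →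
  ∃ λ i → (∀ k → k < n → 1 ≤ f (i + 2 * k)) ×
          (∀ x → x < suc (2 * n) → 1 ≤ f x → ∃ λ k → k < n × x ≡ (i + 2 * k) % suc (2 * n))
sparse-saturated-odd-cycle {f} n@(suc l) _ sp periodic total with sparse-odd-cycle-gap n sp periodic
... | z , z<m , fz≡0 , fsz≡0 = i , occupied , only-occupied
  where
  m = suc (2 * n)
  i = z + 2
  fz+1≡0 : f (z + 1) ≡ 0
  fz+1≡0 = trans (cong f (+-comm z 1)) fsz≡0
  m≡3+2l : m ≡ 3 + 2 * l
  m≡3+2l = cong suc (*-suc 2 l)
  window-full : suc l ≤ sumUpTo (λ r → f (i + r)) (suc (2 * l))
  window-full = begin
    n                                                    ≤⟨ total ⟩
    sumUpTo f m                                          ≡⟨ sumUpTo-rotate f m periodic z ⟨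
    sumUpTo (λ r → f (z + r)) m                          ≡⟨ cong (sumUpTo (λ r → f (z + r))) m≡3+2l ⟩
    f (z + 0) + (f (z + 1) + sumUpTo (λ r → f (z + (2 + r))) (suc (2 * l)))
      ≡⟨ cong₂ _+_ (trans (cong f (+-identityʳ z)) fz≡0)
                   (cong₂ _+_ fz+1≡0 (sumUpTo-cong (suc (2 * l)) λ {r} _ → cong f (sym (+-assoc z 2 r)))) ⟩
    sumUpTo (λ r → f (i + r)) (suc (2 * l))              ∎
    where open ≤-Reasoning
  occupied : ∀ k → k < n → 1 ≤ f (i + 2 * k)
  occupied k k<n = sparse-saturated-even (sparse-shift sp i) l window-full k (s≤s⁻¹ k<n)
  empty-absurd : ∀ {y} → f y ≡ 0 → 1 ≤ f y → ∀ {A : Set} → A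
  empty-absurd fy≡0 fy≥1 = ⊥-elim (1+n≰n (subst (1 ≤_) fy≡0 fy≥1))
  only-occupied : ∀ x → x < m → 1 ≤ f x → ∃ λ k → k < n × x ≡ (i + 2 * k) % m
  only-occupied x x<m fx≥1 with cyclic-offset m periodic z<m x<m
  ... | zero , _ , fz+0≡fx , _ = empty-absurd (trans (cong f (+-identityʳ z)) fz≡0) (subst (1 ≤_) (sym fz+0≡fx) fx≥1)
  ... | suc zero , _ , fz+1≡fx , _ = empty-absurd fz+1≡0 (subst (1 ≤_) (sym fz+1≡fx) fx≥1)
  ... | suc (suc r) , r<m , fz+r≡fx , z+r≡x
      with sparse-saturated-support (sparse-shift sp i) l window-full r
             (s≤s⁻¹ (s≤s⁻¹ (s≤s⁻¹ (subst (suc (suc (suc r)) ≤_) m≡3+2l r<m))))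
             (subst (1 ≤_) (trans (sym fz+r≡fx) (cong f (sym (+-assoc z 2 r)))) fx≥1)
  ...   | k , k≤l , refl = k , s≤s k≤l , trans (sym z+r≡x) (cong (_% m) (sym (+-assoc z 2 (2 * k))))

module _ (m : ℕ) .{{_ : NonZero m}} where

  toℕ-mod : ∀ x → toℕ (x mod m) ≡ x % m
  toℕ-mod x = toℕ-fromℕ< _

  mod-toℕ : ∀ (p : Fin m) → toℕ p mod m ≡ p
  mod-toℕ p = toℕ-injective (trans (toℕ-mod (toℕ p)) (m<n⇒m%n≡m (toℕ<n p)))

  mod-cong : ∀ x y → x % m ≡ y % m → x mod m ≡ y mod m
  mod-cong x y eq = toℕ-injective (trans (toℕ-mod x) (trans eq (sym (toℕ-mod y))))

  mod-+-periodic : ∀ x → (x + m) mod m ≡ x mod m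
  mod-+-periodic x = mod-cong (x + m) x ([m+n]%n≡m%n x m)

  ≡-mod⇔toℕ-≡ : ∀ {x} → x < m → ∀ (p : Fin m) → p ≡ x mod m ⇔ toℕ p ≡ x
  ≡-mod⇔toℕ-≡ {x} x<m p = mk⇔
    (λ p≡x → trans (cong toℕ p≡x) (trans (toℕ-mod x) (m<n⇒m%n≡m x<m)))
    (λ toℕp≡x → trans (sym (mod-toℕ p)) (cong (_mod m) toℕp≡x))

  +1-mod-≢ : 1 < m → ∀ {x} → x < m → (x + 1) % m ≢ x
  +1-mod-≢ 1<m {x} x<m x+1%m≡x with x + 1 <? m
  ... | yes x+1<m = m+1+n≢m x (trans (sym (m<n⇒m%n≡m x+1<m)) x+1%m≡x)
  ... | no x+1≮m  = <⇒≢ 1<m (trans (cong (_+ 1) (sym x≡0)) x+1≡m)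
    where
    x+1≡m : x + 1 ≡ m
    x+1≡m = ≤-antisym (subst (_≤ m) (+-comm 1 x) x<m) (≮⇒≥ x+1≮m)
    x≡0 : x ≡ 0
    x≡0 = trans (sym x+1%m≡x) (trans (cong (_% m) x+1≡m) (n%n≡0 m))

shift-mod : ∀ n x d → shift n (x mod ringLen n) d ≡ (x + d) mod ringLen n
shift-mod n x d = mod-cong m (toℕ (x mod m) + d) (x + d) (begin
  (toℕ (x mod m) + d) % m  ≡⟨ cong (λ y → (y + d) % m) (toℕ-mod m x) ⟩
  (x % m + d) % m          ≡⟨ %-distribˡ-+ (x % m) d m ⟩
  (x % m % m + d % m) % m  ≡⟨ cong (λ y → (y + d % m) % m) (m%n%n≡m%n x m) ⟩
  (x % m + d % m) % m      ≡⟨ %-distribˡ-+ x d m ⟨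
  (x + d) % m              ∎)
  where m = ringLen n; open ≡-Reasoning

shift-suc-≢ : ∀ {n} → 1 ≤ n → (p : Fin (ringLen n)) → p ≢ shift n p 1
shift-suc-≢ {n} 1≤n p p≡p+1 = +1-mod-≢ (ringLen n) (s≤s (≤-trans 1≤n (m≤m+n n (n + 0)))) (toℕ<n p)
  (sym (trans (cong toℕ p≡p+1) (toℕ-mod (ringLen n) (toℕ p + 1))))

module _ {A : Set} {P : A → Set} (P? : Decidable P) where

  length-filter-∷ : ∀ x xs →
    length (filter P? (x ∷ xs)) ≡ (if does (P? x) then 1 else 0) + length (filter P? xs)
  length-filter-∷ x xs with does (P? x)
  ... | true  = refl
  ... | false = refl

  filter-nonempty : ∀ xs → 1 ≤ length (filter P? xs) → ∃ λ x → x ∈ xs × P x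
  filter-nonempty (x ∷ xs) nonempty with P? x
  ... | yes px = x , here refl , px
  ... | no _ with filter-nonempty xs nonempty
  ...   | y , y∈xs , py = y , there y∈xs , py

module _ {A : Set} {P Q : A → Set} (P? : Decidable P) (Q? : Decidable Q) (R : A → A → Set)
         (disjoint : ∀ {x} → P x → ¬ Q x)
         (clique : ∀ {x y} → x ≢ y → P x ⊎ Q x → P y ⊎ Q y → R x y) where

  filter-clique-rest≡0 : ∀ {x xs} → All (x ≢_) xs → (∀ {u v} → u ∈ x ∷ xs → v ∈ x ∷ xs → ¬ R u v) →
                       P x ⊎ Q x → length (filter P? xs) + length (filter Q? xs) ≡ 0
  filter-clique-rest≡0 {x} {xs} x∉xs independent pqx =
    cong₂ _+_ (cong length (filter-none P? (All.tabulate (λ y∈ → outsider y∈ ∘ inj₁))))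
              (cong length (filter-none Q? (All.tabulate (λ y∈ → outsider y∈ ∘ inj₂))))
    where
    outsider : ∀ {y} → y ∈ xs → ¬ (P y ⊎ Q y)
    outsider y∈ pqy = independent (here refl) (there y∈) (clique (All.lookup x∉xs y∈) pqx pqy)

  filter-clique-≤1 : ∀ {xs} → Unique xs → (∀ {u v} → u ∈ xs → v ∈ xs → ¬ R u v) →
                     length (filter P? xs) + length (filter Q? xs) ≤ 1
  filter-clique-≤1 {[]} _ _ = z≤n
  filter-clique-≤1 {x ∷ xs} (x∉xs ∷ unique) independent with P? x | Q? x
  ... | yes px | yes qx = ⊥-elim (disjoint px qx)
  ... | yes px | no _   = s≤s (≤-reflexive (filter-clique-rest≡0 x∉xs independent (inj₁ px)))
  ... | no _   | yes qx = subst (_≤ 1) (sym (+-suc _ _))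
                            (s≤s (≤-reflexive (filter-clique-rest≡0 x∉xs independent (inj₂ qx))))
  ... | no _   | no _   = filter-clique-≤1 unique (λ u∈ v∈ → independent (there u∈) (there v∈))

module RingGraph (n : ℕ) (a : Fin (ringLen n) → ℕ) where

  private
    m = ringLen n
    V = Vertex n a

  _≟ᵛ_ : (u v : V) → Dec (u ≡ v)
  _≟ᵛ_ = ≡-dec _≟ᶠ_ _≟ᶠ_

  classSize : Fin m → List V → ℕ
  classSize p S = length (filter (λ v → proj₁ v ≟ᶠ p) S)

  classSize-sum : ∀ S → sumUpTo (λ x → classSize (x mod m) S) m ≡ length S
  classSize-sum [] = sumUpTo-zero m
  classSize-sum (v ∷ S) = begin
    sumUpTo (λ x → classSize (x mod m) (v ∷ S)) m
      ≡⟨ sumUpTo-cong m (λ {x} _ → length-filter-∷ (λ w → proj₁ w ≟ᶠ x mod m) v S) ⟩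
    sumUpTo (λ x → δ x + classSize (x mod m) S) m
      ≡⟨ sumUpTo-+ δ (λ x → classSize (x mod m) S) m ⟩
    sumUpTo δ m + sumUpTo (λ x → classSize (x mod m) S) m
      ≡⟨ cong₂ _+_ δ-sum (classSize-sum S) ⟩
    1 + length S ∎
    where
    open ≡-Reasoning
    δ : ℕ → ℕ
    δ x = if does (proj₁ v ≟ᶠ x mod m) then 1 else 0
    δ-sum : sumUpTo δ m ≡ 1
    δ-sum = trans (sumUpTo-cong m λ x<m → cong (λ b → if b then 1 else 0)
                    (does-⇔ (≡-mod⇔toℕ-≡ m x<m (proj₁ v)) (proj₁ v ≟ᶠ _) (toℕ (proj₁ v) ≟ _)))
                  (sumUpTo-indicator (toℕ<n (proj₁ v)))

  classSize-pos⇒∈ : ∀ {p S} → 1 ≤ classSize p S → ∃ λ g → (p , g) ∈ S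
  classSize-pos⇒∈ {p} {S} pos with filter-nonempty (λ v → proj₁ v ≟ᶠ p) S pos
  ... | (.p , g) , g∈S , refl = g , g∈S

  ∈⇒classSize-pos : ∀ {v S} → v ∈ S → 1 ≤ classSize (proj₁ v) S
  ∈⇒classSize-pos v∈S = filter-some (λ w → proj₁ w ≟ᶠ _) (Any.map (λ v≡w → cong proj₁ (sym v≡w)) v∈S)

  classSize-adjacent-≤1 : 1 ≤ n → ∀ {S} → Unique S → Independent n a S →
                          ∀ p → classSize p S + classSize (shift n p 1) S ≤ 1
  classSize-adjacent-≤1 1≤n unique independent p =
    filter-clique-≤1 (λ v → proj₁ v ≟ᶠ p) (λ v → proj₁ v ≟ᶠ shift n p 1) (Adj {n} {a})
                     (λ {v} → disjoint {v}) clique unique independent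
    where
    disjoint : ∀ {v : V} → proj₁ v ≡ p → proj₁ v ≢ shift n p 1
    disjoint v∈p v∈p+1 = shift-suc-≢ 1≤n p (trans (sym v∈p) v∈p+1)
    clique : ∀ {u v : V} → u ≢ v → proj₁ u ≡ p ⊎ proj₁ u ≡ shift n p 1 →
             proj₁ v ≡ p ⊎ proj₁ v ≡ shift n p 1 → Adj {n} {a} u v
    clique u≢v (inj₁ refl) (inj₁ v∈p)   = u≢v , inj₁ v∈p
    clique u≢v (inj₁ refl) (inj₂ v∈p+1) = u≢v , inj₂ (inj₁ v∈p+1)
    clique u≢v (inj₂ refl) (inj₁ refl)  = u≢v , inj₂ (inj₂ refl)
    clique u≢v (inj₂ refl) (inj₂ v∈p+1) = u≢v , inj₁ v∈p+1

  InPi-intro : ∀ {S} → Independent n a S → (i : Fin m) →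
               (∀ (k : Fin n) → 1 ≤ classSize (shift n i (2 * toℕ k)) S) →
               (∀ {v} → v ∈ S → ∃ λ (k : Fin n) → proj₁ v ≡ shift n i (2 * toℕ k)) →
               InPi n a i S
  InPi-intro {S} independent i occupied covered = pick , λ v → mk⇔ (to v) (from v)
    where
    chosen : ∀ k → ∃ λ g → (shift n i (2 * toℕ k) , g) ∈ S
    chosen k = classSize-pos⇒∈ (occupied k)
    pick : (k : Fin n) → Fin (a (shift n i (2 * toℕ k)))
    pick k = proj₁ (chosen k)
    from : ∀ v → ∃ (λ k → v ≡ (shift n i (2 * toℕ k) , pick k)) → v ∈ S
    from _ (k , refl) = proj₂ (chosen k)
    to : ∀ v → v ∈ S → ∃ (λ k → v ≡ (shift n i (2 * toℕ k) , pick k))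
    to v v∈S with covered v∈S
    ... | k , v∈class with v ≟ᵛ (shift n i (2 * toℕ k) , pick k)
    ...   | yes v≡chosen = k , v≡chosen
    ...   | no v≢chosen = ⊥-elim (independent v∈S (proj₂ (chosen k)) (v≢chosen , inj₁ (sym v∈class)))

  evenClass : Fin n → Fin m
  evenClass k = (2 * toℕ k) mod m

  toℕ-evenClass : ∀ k → toℕ (evenClass k) ≡ 2 * toℕ k
  toℕ-evenClass k = trans (toℕ-mod m (2 * toℕ k)) (m<n⇒m%n≡m (s≤s (*-monoʳ-≤ 2 (<⇒≤ (toℕ<n k)))))

  evenClass-injective : ∀ {k k′} → evenClass k ≡ evenClass k′ → k ≡ k′
  evenClass-injective {k} {k′} eq = toℕ-injective (*-cancelˡ-≡ _ _ 2
    (trans (sym (toℕ-evenClass k)) (trans (cong toℕ eq) (toℕ-evenClass k′))))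

  evenClass-nonadjacent : ∀ k k′ → evenClass k′ ≢ shift n (evenClass k) 1
  evenClass-nonadjacent k k′ eq = even≢odd (toℕ k′) (toℕ k) (begin
    2 * toℕ k′                         ≡⟨ toℕ-evenClass k′ ⟨
    toℕ (evenClass k′)                 ≡⟨ cong toℕ eq ⟩
    toℕ (shift n (evenClass k) 1)      ≡⟨ toℕ-mod m (toℕ (evenClass k) + 1) ⟩
    (toℕ (evenClass k) + 1) % m        ≡⟨ cong (λ y → (y + 1) % m) (toℕ-evenClass k) ⟩
    (2 * toℕ k + 1) % m                ≡⟨ cong (_% m) (+-comm _ 1) ⟩
    suc (2 * toℕ k) % m                ≡⟨ m<n⇒m%n≡m (s≤s (*-monoʳ-< 2 (toℕ<n k))) ⟩
    suc (2 * toℕ k)                    ∎)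
    where open ≡-Reasoning

  IsMaxIndependent⇒n≤length : (∀ i → 1 ≤ a i) → ∀ {S} → IsMaxIndependent n a S → n ≤ length S
  IsMaxIndependent⇒n≤length nonempty {S} (_ , _ , maximum) =
    subst (_≤ length S) (length-tabulate evenVertex)
          (maximum evens (tabulate⁺ evenVertex-injective) evens-independent)
    where
    evenVertex : Fin n → V
    evenVertex k = evenClass k , fromℕ< (nonempty (evenClass k))
    evenVertex-injective : ∀ {k k′} → evenVertex k ≡ evenVertex k′ → k ≡ k′
    evenVertex-injective {k} {k′} = evenClass-injective {k} {k′} ∘ cong proj₁
    evens = tabulate evenVertex
    evens-independent : Independent n a evens
    evens-independent u∈ v∈ (u≢v , adjacent) with ∈-tabulate⁻ u∈ | ∈-tabulate⁻ v∈
    ... | k , refl | k′ , refl with adjacent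
    ...   | inj₁ same          = u≢v (cong evenVertex (evenClass-injective {k} {k′} (sym same)))
    ...   | inj₂ (inj₁ v-next) = evenClass-nonadjacent k k′ v-next
    ...   | inj₂ (inj₂ u-next) = evenClass-nonadjacent k′ k u-next

  InPi-from-residues : ∀ {S} → Independent n a S →
    (∃ λ i → (∀ k → k < n → 1 ≤ classSize ((i + 2 * k) mod m) S) ×
             (∀ x → x < m → 1 ≤ classSize (x mod m) S → ∃ λ k → k < n × x ≡ (i + 2 * k) % m)) →
    ∃ λ i → InPi n a i S
  InPi-from-residues {S} independent (i , occupied , covered) =
    i mod m , InPi-intro independent (i mod m) occupied′ covered′
    where
    occupied′ : ∀ k → 1 ≤ classSize (shift n (i mod m) (2 * toℕ k)) S
    occupied′ k = subst (λ p → 1 ≤ classSize p S) (sym (shift-mod n i (2 * toℕ k))) (occupied (toℕ k) (toℕ<n k))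
    covered′ : ∀ {v} → v ∈ S → ∃ λ (k : Fin n) → proj₁ v ≡ shift n (i mod m) (2 * toℕ k)
    covered′ {p , _} v∈S with covered (toℕ p) (toℕ<n p)
                                (subst (λ q → 1 ≤ classSize q S) (sym (mod-toℕ m p)) (∈⇒classSize-pos v∈S))
    ... | k , k<n , p≡i+2k = fromℕ< k<n , (begin
      p                                        ≡⟨ toℕ-injective (trans p≡i+2k (sym (toℕ-mod m (i + 2 * k)))) ⟩
      (i + 2 * k) mod m                        ≡⟨ shift-mod n i (2 * k) ⟨
      shift n (i mod m) (2 * k)                ≡⟨ cong (λ j → shift n (i mod m) (2 * j)) (toℕ-fromℕ< k<n) ⟨
      shift n (i mod m) (2 * toℕ (fromℕ< k<n)) ∎)
      where open ≡-Reasoning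

lemma2p10 : (n : ℕ) → 2 ≤ n → (a : Fin (ringLen n) → ℕ) → IsRing n a →
    (S : List (Vertex n a)) → IsMaxIndependent n a S → ∃ (λ i → InPi n a i S)
lemma2p10 n 2≤n a (nonempty , _ , _) S maximal@(unique , independent , _) =
  InPi-from-residues independent
    (sparse-saturated-odd-cycle n 1≤n occupancy-sparse occupancy-periodic occupancy-total)
  where
  open RingGraph n a
  m = ringLen n
  1≤n = ≤-trans (s≤s z≤n) 2≤n
  occupancy : ℕ → ℕ
  occupancy x = classSize (x mod m) S
  occupancy-sparse : Sparse occupancy
  occupancy-sparse = sparse λ x → subst (λ p → occupancy x + classSize p S ≤ 1)
    (trans (shift-mod n x 1) (cong (_mod m) (+-comm x 1)))
    (classSize-adjacent-≤1 1≤n unique independent (x mod m))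
  occupancy-periodic : Periodic m occupancy
  occupancy-periodic x = cong (λ p → classSize p S) (mod-+-periodic m x)
  occupancy-total : n ≤ sumUpTo occupancy m
  occupancy-total = subst (n ≤_) (sym (classSize-sum S)) (IsMaxIndependent⇒n≤length nonempty maximal)
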